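{- Let $m,n$ be coprime positive integers and let $D$ be an $(m,n)$-Dyck path. Then $S(\bar D)=\max(S(D))-S(D)$ and $E(\bar D)=\max(E(D))-E(D)$, where for a set $A$ of integers and an integer $c$, $c-A=\{c-a:a\in A\}$.
   Context: A path is a word $p_1\cdots p_k$ in the letters $N$ (unit step $(0,1)$) and $E$ (unit step $(1,0)$), drawn as the lattice points $P_0=(0,0),P_1,\dots,P_k$ with $P_i-P_{i-1}$ the $i$-th step. An $(m,n)$-Dyck path is a path from $(0,0)$ to $(m,n)$ that never goes below the line $y=\frac nm x$. The rank of a lattice point $(a,b)$ is $r(a,b)=mb-na$. For an $(m,n)$-Dyck path $D$ with lattice points $P_0,\dots,P_{m+n}$: $S(D)$ is the set of ranks of the south ends of $D$, i.e. of the points $P_{i-1}$ with $p_i=N$ (starting points of $N$ steps); $E(D)$ is the set of ranks of the east ends of $D$, i.e. of the points $P_i$ with $p_i=E$ (end points of $E$ steps). For a path $Q$, $Q^{rev}$ is the path whose word is that of $Q$ read backwards. Rank complement: write $D=Q_1Q_2$, where $Q_1$ consists of the steps up to the (unique) lattice point of $D$ of maximal rank; then $\bar D=Q_1^{rev}Q_2^{rev}$, again an $(m,n)$-Dyck path. -}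

module Defs where

open import Data.Nat as ℕ using (ℕ; zero; suc)
open import Data.Integer as ℤ using (ℤ; +_; _-_; _*_; _⊔_; _≤_)
open import Data.Product using (_×_; _,_)
open import Data.List using (List; []; _∷_; _++_; reverse; take; drop; length; filter)
open import Data.List.Relation.Unary.All using (All)
open import Relation.Binary.PropositionalEquality using (_≡_)
open import Relation.Nullary using (yes; no)

data Step : Set where
  N E : Step

Path : Set
Path = List Step

Point : Set
Point = ℕ × ℕ

rank : ℕ → ℕ → Point → ℤ
rank m n (a , b) = (+ m) * (+ b) - (+ n) * (+ a)

move : Point → Step → Point
move (a , b) N = (a , suc b)
move (a , b) E = (suc a , b)

pointsFrom : Point → Path → List Point
pointsFrom P []      = P ∷ []
pointsFrom P (s ∷ p) = P ∷ pointsFrom (move P s) p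

points : Path → List Point
points = pointsFrom (0 , 0)

countN countE : Path → ℕ
countN []      = 0
countN (N ∷ p) = suc (countN p)
countN (E ∷ p) = countN p
countE []      = 0
countE (N ∷ p) = countE p
countE (E ∷ p) = suc (countE p)

-- (m,n)-Dyck path: ends at (m,n) (m E-steps, n N-steps) and never goes
-- below the line y = (n/m) x, i.e. every lattice point has rank ≥ 0.
IsDyck : ℕ → ℕ → Path → Set
IsDyck m n D = countE D ≡ m × countN D ≡ n
             × All (λ P → + 0 ≤ rank m n P) (points D)

southFrom : ℕ → ℕ → Point → Path → List ℤ
southFrom m n P []      = []
southFrom m n P (N ∷ p) = rank m n P ∷ southFrom m n (move P N) p
southFrom m n P (E ∷ p) = southFrom m n (move P E) p

eastFrom : ℕ → ℕ → Point → Path → List ℤ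
eastFrom m n P []      = []
eastFrom m n P (N ∷ p) = eastFrom m n (move P N) p
eastFrom m n P (E ∷ p) = rank m n (move P E) ∷ eastFrom m n (move P E) p

S Ea : ℕ → ℕ → Path → List ℤ
S m n D  = southFrom m n (0 , 0) D
Ea m n D = eastFrom m n (0 , 0) D

-- maximum of a list of integers (base value 0; all ranks of a Dyck path
-- are ≥ 0 and the sets in question are nonempty, so this is the true max)
maxℤ : List ℤ → ℤ
maxℤ []       = + 0
maxℤ (x ∷ xs) = x ⊔ maxℤ xs

indexOf : ℤ → List ℤ → ℕ
indexOf c []       = 0
indexOf c (x ∷ xs) with x ℤ.≟ c
... | yes _ = 0
... | no  _ = suc (indexOf c xs)

ranksOfPoints : ℕ → ℕ → Path → List ℤ
ranksOfPoints m n D = Data.List.map (rank m n) (points D)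

-- index k of the (unique, for coprime m n) lattice point of maximal rank
maxRankIndex : ℕ → ℕ → Path → ℕ
maxRankIndex m n D = indexOf (maxℤ (ranksOfPoints m n D)) (ranksOfPoints m n D)

complement : ℕ → ℕ → Path → Path
complement m n D = reverse (take k D) ++ reverse (drop k D)
  where k = maxRankIndex m n D

open import Data.List.Membership.Propositional using (_∈_)
open import Data.Product using (∃)
open import Function.Bundles using (_⇔_)

_≐_-minus_ : List ℤ → ℤ → List ℤ → Set
B ≐ c -minus A = ∀ x → (x ∈ B) ⇔ ∃ (λ a → a ∈ A × x ≡ c - a)

module Submission where

-- Along a path the rank changes by +m at an N step and by -n at an
-- E step, so everything happens on the integer "rank walk" of the path.
-- Reversing a walk p reflects its ranks: if the reversed walk is started so
-- that its points are c - (ranks of p), then an N step a → a + m of p is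
-- traversed in the reversed walk from c - (a + m), and an E step ending at
-- e = a - n is traversed to c - a = (c - n) - e.  Cutting D = Q₁Q₂ at its
-- maximal point (rank M) and choosing c = M makes the reflections of both
-- halves fit together, so S(D̄) = (M - m) - S(D) and E(D̄) = (M - n) - E(D)
-- as sets.  Finally M is reached by an N step and left by an E step (it is
-- neither the first nor the last point, both of rank 0), which gives
-- max S(D) = M - m and max E(D) = M - n.

open import Defs
open import Data.Nat using (ℕ; _≥_)
open import Data.Nat.Coprimality using (Coprime)
open import Data.Product using (_×_)
import Data.Nat as ℕ
open import Data.Integer as ℤ using (ℤ; +_; _+_; _-_; -_; _*_; +<+)
import Data.Integer.Properties as ℤP
open import Data.Integer.Tactic.RingSolver using (solve-∀)
open import Data.List using (List; []; _∷_; _++_; reverse; take; drop; map; [_])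
import Data.List.Properties as ListP
open import Data.List.Membership.Propositional using (_∈_)
import Data.List.Membership.Propositional.Properties as ∈P
open import Data.List.Relation.Unary.Any using (here; there)
import Data.List.Relation.Unary.Any.Properties as AnyP
open import Data.List.Relation.Unary.All as All using (All; []; _∷_)
import Data.List.Relation.Unary.All.Properties as AllP
open import Data.Product using (∃; _,_; proj₁; proj₂)
open import Data.Sum using (_⊎_; inj₁; inj₂)
open import Data.Empty using (⊥-elim)
open import Function.Bundles using (mk⇔)
open import Relation.Binary.PropositionalEquality hiding ([_])
open import Relation.Nullary using (yes; no; contradiction)

maxℤ-ub : ∀ {x} xs → x ∈ xs → x ℤ.≤ maxℤ xs
maxℤ-ub (y ∷ xs) (here refl) = ℤP.i≤i⊔j y (maxℤ xs)
maxℤ-ub (y ∷ xs) (there x∈) = ℤP.≤-trans (maxℤ-ub xs x∈) (ℤP.i≤j⊔i y (maxℤ xs))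

maxℤ-dominates : ∀ xs → All (ℤ._≤ maxℤ xs) xs
maxℤ-dominates xs = All.tabulate (maxℤ-ub xs)

maxℤ-lub : ∀ {c} xs → All (ℤ._≤ c) xs → + 0 ℤ.≤ c → maxℤ xs ℤ.≤ c
maxℤ-lub []       []         0≤c = 0≤c
maxℤ-lub (y ∷ xs) (y≤c ∷ ≤c) 0≤c = ℤP.⊔-lub y≤c (maxℤ-lub xs ≤c 0≤c)

maxℤ-unique : ∀ {c} xs → c ∈ xs → All (ℤ._≤ c) xs → + 0 ℤ.≤ c → maxℤ xs ≡ c
maxℤ-unique xs c∈ ≤c 0≤c = ℤP.≤-antisym (maxℤ-lub xs ≤c 0≤c) (maxℤ-ub xs c∈)

maxℤ-attained : ∀ xs → maxℤ xs ∈ xs ⊎ maxℤ xs ≡ + 0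
maxℤ-attained [] = inj₂ refl
maxℤ-attained (x ∷ xs) with ℤP.⊔-sel x (maxℤ xs)
... | inj₁ x⊔≡x rewrite x⊔≡x = inj₁ (here refl)
... | inj₂ x⊔≡max rewrite x⊔≡max with maxℤ-attained xs
...   | inj₁ max∈ = inj₁ (there max∈)
...   | inj₂ max≡0 = inj₂ max≡0

reflect : ℤ → ℤ → ℤ
reflect c a = c - a

reflect-≐ : ∀ c (A B : List ℤ) →
  (reverse (map (reflect c) A) ++ reverse (map (reflect c) B)) ≐ c -minus (A ++ B)
reflect-≐ c A B x = mk⇔ to from
  where
  from-reflected : ∀ {X : List ℤ} → x ∈ reverse (map (reflect c) X) → ∃ λ a → a ∈ X × x ≡ c - a
  from-reflected {X} x∈ = ∈P.∈-map⁻ (reflect c) (AnyP.reverse⁻ {xs = map (reflect c) X} x∈)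

  to : x ∈ reverse (map (reflect c) A) ++ reverse (map (reflect c) B) → ∃ λ a → a ∈ A ++ B × x ≡ c - a
  to x∈ with ∈P.∈-++⁻ (reverse (map (reflect c) A)) x∈
  ... | inj₁ x∈A with from-reflected {A} x∈A
  ...   | a , a∈ , x≡ = a , ∈P.∈-++⁺ˡ a∈ , x≡
  to x∈ | inj₂ x∈B with from-reflected {B} x∈B
  ...   | a , a∈ , x≡ = a , ∈P.∈-++⁺ʳ A a∈ , x≡

  from : (∃ λ a → a ∈ A ++ B × x ≡ c - a) → x ∈ reverse (map (reflect c) A) ++ reverse (map (reflect c) B)
  from (a , a∈ , refl) with ∈P.∈-++⁻ A a∈
  ... | inj₁ a∈A = ∈P.∈-++⁺ˡ (AnyP.reverse⁺ (∈P.∈-map⁺ (reflect c) a∈A))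
  ... | inj₂ a∈B = ∈P.∈-++⁺ʳ _ (AnyP.reverse⁺ (∈P.∈-map⁺ (reflect c) a∈B))

module Walk (m n : ℕ) where

  weight : Step → ℤ
  weight N = + m
  weight E = - + n

  δ : Path → ℤ
  δ []      = + 0
  δ (s ∷ p) = weight s + δ p

  ranks : ℤ → Path → List ℤ
  ranks r []      = r ∷ []
  ranks r (s ∷ p) = r ∷ ranks (r + weight s) p

  south : ℤ → Path → List ℤ
  south r []      = []
  south r (N ∷ p) = r ∷ south (r + weight N) p
  south r (E ∷ p) = south (r + weight E) p

  east : ℤ → Path → List ℤ
  east r []      = []
  east r (N ∷ p) = east (r + weight N) p
  east r (E ∷ p) = (r + weight E) ∷ east (r + weight E) p

  ranks-head : ∀ r p → r ∈ ranks r p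
  ranks-head r []      = here refl
  ranks-head r (s ∷ p) = here refl

  south⊆ranks : ∀ {P : ℤ → Set} r p → All P (ranks r p) → All P (south r p)
  south⊆ranks r []      _        = []
  south⊆ranks r (N ∷ p) (Pr ∷ ps) = Pr ∷ south⊆ranks (r + weight N) p ps
  south⊆ranks r (E ∷ p) (_  ∷ ps) = south⊆ranks (r + weight E) p ps

  east⊆ranks : ∀ {P : ℤ → Set} r p → All P (ranks r p) → All P (east r p)
  east⊆ranks r []      _        = []
  east⊆ranks r (N ∷ p) (_ ∷ ps) = east⊆ranks (r + weight N) p ps
  east⊆ranks r (E ∷ p) (_ ∷ ps) =
    All.lookup ps (ranks-head (r + weight E) p) ∷ east⊆ranks (r + weight E) p ps

  δ-++ : ∀ p q → δ (p ++ q) ≡ δ p + δ q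
  δ-++ []      q = sym (ℤP.+-identityˡ (δ q))
  δ-++ (s ∷ p) q = trans (cong (λ d → weight s + d) (δ-++ p q)) (sym (ℤP.+-assoc (weight s) (δ p) (δ q)))

  δ-reverse : ∀ p → δ (reverse p) ≡ δ p
  δ-reverse []      = refl
  δ-reverse (s ∷ p) = begin
    δ (reverse (s ∷ p))             ≡⟨ cong δ (ListP.unfold-reverse s p) ⟩
    δ (reverse p ++ [ s ])          ≡⟨ δ-++ (reverse p) [ s ] ⟩
    δ (reverse p) + (weight s + + 0) ≡⟨ cong (_+ (weight s + + 0)) (δ-reverse p) ⟩
    δ p + (weight s + + 0)          ≡⟨ swap-unit (δ p) (weight s) ⟩
    weight s + δ p                  ∎
    where
    open ≡-Reasoning
    swap-unit : ∀ d w → d + (w + + 0) ≡ w + d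
    swap-unit = solve-∀

  south-++ : ∀ r p q → south r (p ++ q) ≡ south r p ++ south (r + δ p) q
  south-++ r []      q = cong (λ r' → south r' q) (sym (ℤP.+-identityʳ r))
  south-++ r (N ∷ p) q = cong (r ∷_) (trans (south-++ (r + weight N) p q)
    (cong (λ r' → south (r + weight N) p ++ south r' q) (ℤP.+-assoc r (weight N) (δ p))))
  south-++ r (E ∷ p) q = trans (south-++ (r + weight E) p q)
    (cong (λ r' → south (r + weight E) p ++ south r' q) (ℤP.+-assoc r (weight E) (δ p)))

  east-++ : ∀ r p q → east r (p ++ q) ≡ east r p ++ east (r + δ p) q
  east-++ r []      q = cong (λ r' → east r' q) (sym (ℤP.+-identityʳ r))
  east-++ r (N ∷ p) q = trans (east-++ (r + weight N) p q)
    (cong (λ r' → east (r + weight N) p ++ east r' q) (ℤP.+-assoc r (weight N) (δ p)))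
  east-++ r (E ∷ p) q = cong ((r + weight E) ∷_) (trans (east-++ (r + weight E) p q)
    (cong (λ r' → east (r + weight E) p ++ east r' q) (ℤP.+-assoc r (weight E) (δ p))))

  reversed-start : ∀ {c} r r' s p → r' + (r + δ (s ∷ p)) ≡ c →
    r' + δ (reverse p) ≡ c - (r + weight s)
  reversed-start {c} r r' s p reflected = begin
    r' + δ (reverse p)                        ≡⟨ cong (λ d → r' + d) (δ-reverse p) ⟩
    r' + δ p                                  ≡⟨ regroup r' r (weight s) (δ p) ⟩
    r' + (r + (weight s + δ p)) - (r + weight s) ≡⟨ cong (_- (r + weight s)) reflected ⟩
    c - (r + weight s)                        ∎
    where
    open ≡-Reasoning
    regroup : ∀ r' r w d → r' + d ≡ r' + (r + (w + d)) - (r + w)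
    regroup = solve-∀

  reflected-tail : ∀ {c} r r' s p → r' + (r + δ (s ∷ p)) ≡ c → r' + (r + weight s + δ p) ≡ c
  reflected-tail r r' s p = trans (cong (λ e → r' + e) (ℤP.+-assoc r (weight s) (δ p)))

  -- An N step a → a + m of p is traversed by the reversed walk from
  -- c - (a + m) = (c - m) - a.
  south-reverse : ∀ {c} r r' p → r' + (r + δ p) ≡ c →
    south r' (reverse p) ≡ reverse (map (reflect (c - + m)) (south r p))
  south-reverse r r' [] _ = refl
  south-reverse {c} r r' (N ∷ p) reflected = begin
    south r' (reverse (N ∷ p))                       ≡⟨ cong (south r') (ListP.unfold-reverse N p) ⟩
    south r' (reverse p ++ [ N ])                    ≡⟨ south-++ r' (reverse p) [ N ] ⟩
    south r' (reverse p) ++ [ r' + δ (reverse p) ]   ≡⟨ cong₂ (λ xs x → xs ++ [ x ])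
                                                          (south-reverse (r + weight N) r' p (reflected-tail r r' N p reflected))
                                                          (trans (reversed-start r r' N p reflected) (regroup c r (+ m))) ⟩
    reverse (map f (south (r + weight N) p)) ++ [ f r ] ≡⟨ ListP.unfold-reverse (f r) (map f (south (r + weight N) p)) ⟨
    reverse (map f (south r (N ∷ p)))                ∎
    where
    open ≡-Reasoning
    f : ℤ → ℤ
    f = reflect (c - + m)
    regroup : ∀ c r k → c - (r + k) ≡ c - k - r
    regroup = solve-∀
  south-reverse {c} r r' (E ∷ p) reflected = begin
    south r' (reverse (E ∷ p))       ≡⟨ cong (south r') (ListP.unfold-reverse E p) ⟩
    south r' (reverse p ++ [ E ])    ≡⟨ south-++ r' (reverse p) [ E ] ⟩
    south r' (reverse p) ++ []       ≡⟨ ListP.++-identityʳ (south r' (reverse p)) ⟩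
    south r' (reverse p)             ≡⟨ south-reverse (r + weight E) r' p (reflected-tail r r' E p reflected) ⟩
    reverse (map (reflect (c - + m)) (south r (E ∷ p))) ∎
    where open ≡-Reasoning

  -- An E step a → a - n of p, with east end e = a - n, is traversed by the
  -- reversed walk to c - a = (c - n) - e.
  east-reverse : ∀ {c} r r' p → r' + (r + δ p) ≡ c →
    east r' (reverse p) ≡ reverse (map (reflect (c - + n)) (east r p))
  east-reverse r r' [] _ = refl
  east-reverse {c} r r' (E ∷ p) reflected = begin
    east r' (reverse (E ∷ p))                       ≡⟨ cong (east r') (ListP.unfold-reverse E p) ⟩
    east r' (reverse p ++ [ E ])                    ≡⟨ east-++ r' (reverse p) [ E ] ⟩
    east r' (reverse p) ++ [ r' + δ (reverse p) + weight E ] ≡⟨ cong₂ (λ xs x → xs ++ [ x ])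
                                                          (east-reverse (r + weight E) r' p (reflected-tail r r' E p reflected))
                                                          (trans (cong (_+ weight E) (reversed-start r r' E p reflected)) (regroup c r (+ n))) ⟩
    reverse (map f (east (r + weight E) p)) ++ [ f (r + weight E) ] ≡⟨ ListP.unfold-reverse (f (r + weight E)) (map f (east (r + weight E) p)) ⟨
    reverse (map f (east r (E ∷ p)))                ∎
    where
    open ≡-Reasoning
    f : ℤ → ℤ
    f = reflect (c - + n)
    regroup : ∀ c r k → c - (r + - k) + - k ≡ c - k - (r + - k)
    regroup = solve-∀
  east-reverse {c} r r' (N ∷ p) reflected = begin
    east r' (reverse (N ∷ p))       ≡⟨ cong (east r') (ListP.unfold-reverse N p) ⟩
    east r' (reverse p ++ [ N ])    ≡⟨ east-++ r' (reverse p) [ N ] ⟩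
    east r' (reverse p) ++ []       ≡⟨ ListP.++-identityʳ (east r' (reverse p)) ⟩
    east r' (reverse p)             ≡⟨ east-reverse (r + weight N) r' p (reflected-tail r r' N p reflected) ⟩
    reverse (map (reflect (c - + n)) (east r (N ∷ p))) ∎
    where open ≡-Reasoning

  -- Maximal points bound the south and east ends: an N step starting at a
  -- reaches rank a + m, and an E step ending at e starts at rank e + n.
  south-below : ∀ {c} r p → All (ℤ._≤ c) (ranks r p) → All (ℤ._≤ c - + m) (south r p)
  south-below r []      _        = []
  south-below {c} r (N ∷ p) (_ ∷ ≤c) =
    subst (ℤ._≤ c - + m) (cancel r (+ m)) (ℤP.+-monoˡ-≤ (- + m) (All.lookup ≤c (ranks-head (r + weight N) p)))
      ∷ south-below (r + weight N) p ≤c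
    where
    cancel : ∀ r k → r + k - k ≡ r
    cancel = solve-∀
  south-below r (E ∷ p) (_ ∷ ≤c) = south-below (r + weight E) p ≤c

  east-below : ∀ {c} r p → All (ℤ._≤ c) (ranks r p) → All (ℤ._≤ c - + n) (east r p)
  east-below r []      _          = []
  east-below r (N ∷ p) (_   ∷ ≤c) = east-below (r + weight N) p ≤c
  east-below r (E ∷ p) (r≤c ∷ ≤c) = ℤP.+-monoˡ-≤ (- + n) r≤c ∷ east-below (r + weight E) p ≤c

  prefix-reaches : ∀ {c} r p → c ∈ ranks r p → r + δ (take (indexOf c (ranks r p)) p) ≡ c
  prefix-reaches {c} r [] c∈ with r ℤ.≟ c
  ... | yes r≡c = trans (ℤP.+-identityʳ r) r≡c
  prefix-reaches r [] (here c≡r) | no r≢c = ⊥-elim (r≢c (sym c≡r))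
  prefix-reaches {c} r (s ∷ p) c∈ with r ℤ.≟ c
  ... | yes r≡c = trans (ℤP.+-identityʳ r) r≡c
  prefix-reaches r (s ∷ p) (here c≡r) | no r≢c = ⊥-elim (r≢c (sym c≡r))
  prefix-reaches r (s ∷ p) (there c∈) | no _ =
    trans (sym (ℤP.+-assoc r (weight s) _)) (prefix-reaches (r + weight s) p c∈)

  maxRank∈ranks : ∀ D → maxℤ (ranks (+ 0) D) ∈ ranks (+ 0) D
  maxRank∈ranks D with maxℤ-attained (ranks (+ 0) D)
  ... | inj₁ max∈ = max∈
  ... | inj₂ max≡0 = subst (_∈ ranks (+ 0) D) (sym max≡0) (ranks-head (+ 0) D)

  peak : Path → ℕ
  peak D = indexOf (maxℤ (ranks (+ 0) D)) (ranks (+ 0) D)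

  flipAt : ℕ → Path → Path
  flipAt k D = reverse (take k D) ++ reverse (drop k D)

  -- If the first
  -- k steps of a closed walk D (δ D ≡ 0) end at rank M, then f of the
  -- flipped path is the reflection of f of D through M - w: both reversed
  -- halves are reflected through the same centre M.
  flip-reflects : (f : ℤ → Path → List ℤ) (w : ℤ) →
    (∀ r p q → f r (p ++ q) ≡ f r p ++ f (r + δ p) q) →
    (∀ {c} r r' p → r' + (r + δ p) ≡ c → f r' (reverse p) ≡ reverse (map (reflect (c - w)) (f r p))) →
    ∀ {M} k D → + 0 + δ (take k D) ≡ M → δ D ≡ + 0 →
    f (+ 0) (flipAt k D) ≐ (M - w) -minus f (+ 0) D
  flip-reflects f w f-++ f-reverse {M} k D reachesM closed =
    subst₂ (λ X Y → X ≐ (M - w) -minus Y) (sym split-flip) (sym split-D)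
      (reflect-≐ (M - w) (f (+ 0) Q₁) (f (+ 0 + δ Q₁) Q₂))
    where
    open ≡-Reasoning
    Q₁ Q₂ : Path
    Q₁ = take k D
    Q₂ = drop k D

    halves-close : δ Q₁ + δ Q₂ ≡ + 0
    halves-close = trans (sym (δ-++ Q₁ Q₂)) (trans (cong δ (ListP.take++drop≡id k D)) closed)

    Q₁-reflected : + 0 + (+ 0 + δ Q₁) ≡ M
    Q₁-reflected = trans (ℤP.+-identityˡ _) reachesM

    Q₂-reflected : + 0 + δ (reverse Q₁) + (+ 0 + δ Q₁ + δ Q₂) ≡ M
    Q₂-reflected = begin
      + 0 + δ (reverse Q₁) + (+ 0 + δ Q₁ + δ Q₂) ≡⟨ cong (λ d → + 0 + d + (+ 0 + δ Q₁ + δ Q₂)) (δ-reverse Q₁) ⟩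
      + 0 + δ Q₁ + (+ 0 + δ Q₁ + δ Q₂)           ≡⟨ regroup (δ Q₁) (δ Q₂) ⟩
      + 0 + δ Q₁ + (δ Q₁ + δ Q₂)                 ≡⟨ cong (λ d → + 0 + δ Q₁ + d) halves-close ⟩
      + 0 + δ Q₁ + + 0                           ≡⟨ ℤP.+-identityʳ _ ⟩
      + 0 + δ Q₁                                 ≡⟨ reachesM ⟩
      M                                          ∎
      where
      regroup : ∀ a b → + 0 + a + (+ 0 + a + b) ≡ + 0 + a + (a + b)
      regroup = solve-∀

    split-D : f (+ 0) D ≡ f (+ 0) Q₁ ++ f (+ 0 + δ Q₁) Q₂
    split-D = trans (cong (f (+ 0)) (sym (ListP.take++drop≡id k D))) (f-++ (+ 0) Q₁ Q₂)

    split-flip : f (+ 0) (flipAt k D)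
      ≡ reverse (map (reflect (M - w)) (f (+ 0) Q₁)) ++ reverse (map (reflect (M - w)) (f (+ 0 + δ Q₁) Q₂))
    split-flip = trans (f-++ (+ 0) (reverse Q₁) (reverse Q₂))
      (cong₂ _++_ (f-reverse (+ 0) (+ 0) Q₁ Q₁-reflected)
                  (f-reverse (+ 0 + δ Q₁) (+ 0 + δ (reverse Q₁)) Q₂ Q₂-reflected))

  module Extremal (m≥1 : m ≥ 1) (n≥1 : n ≥ 1) where

    N-raises : ∀ r → r ℤ.< r + weight N
    N-raises r = subst (ℤ._< r + weight N) (ℤP.+-identityʳ r) (ℤP.+-monoʳ-< r (+<+ m≥1))

    E-lowers : ∀ r → r + weight E ℤ.< r
    E-lowers r = subst (r + weight E ℤ.<_) (ℤP.+-identityʳ r)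
                   (ℤP.+-monoʳ-< r (ℤP.neg-mono-< (+<+ n≥1)))

    -- A point of maximal rank c other than the start is entered by an N
    -- step (an E step would come from a higher point), so c - m ∈ S.
    max-entered-by-N : ∀ {c} r p → c ∈ ranks r p → c ≢ r → All (ℤ._≤ c) (ranks r p) →
      c - + m ∈ south r p
    max-entered-by-N r [] (here c≡r) c≢r _ = ⊥-elim (c≢r c≡r)
    max-entered-by-N r (s ∷ p) (here c≡r) c≢r _ = ⊥-elim (c≢r c≡r)
    max-entered-by-N {c} r (s ∷ p) (there c∈) _ (r≤c ∷ ≤c) with c ℤ.≟ r + weight s
    max-entered-by-N r (N ∷ p) (there c∈) _ (r≤c ∷ ≤c) | yes refl = here (cancel r (+ m))
      where
      cancel : ∀ r k → r + k - k ≡ r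
      cancel = solve-∀
    max-entered-by-N r (E ∷ p) (there c∈) _ (r≤c ∷ ≤c) | yes refl = ⊥-elim (ℤP.<⇒≱ (E-lowers r) r≤c)
    max-entered-by-N r (N ∷ p) (there c∈) _ (r≤c ∷ ≤c) | no c≢next =
      there (max-entered-by-N (r + weight N) p c∈ c≢next ≤c)
    max-entered-by-N r (E ∷ p) (there c∈) _ (r≤c ∷ ≤c) | no c≢next =
      max-entered-by-N (r + weight E) p c∈ c≢next ≤c

    -- A point of maximal rank c other than the end is left by an E step
    -- (an N step would lead to a higher point), so c - n ∈ E.
    max-left-by-E : ∀ {c} r p → c ∈ ranks r p → c ≢ r + δ p → All (ℤ._≤ c) (ranks r p) →
      c - + n ∈ east r p
    max-left-by-E r [] (here c≡r) c≢end _ = ⊥-elim (c≢end (trans c≡r (sym (ℤP.+-identityʳ r))))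
    max-left-by-E {c} r (s ∷ p) c∈ c≢end (_ ∷ ≤c) with c ℤ.≟ r
    max-left-by-E r (N ∷ p) c∈ c≢end (_ ∷ ≤c) | yes refl =
      ⊥-elim (ℤP.<⇒≱ (N-raises r) (All.lookup ≤c (ranks-head (r + weight N) p)))
    max-left-by-E r (E ∷ p) c∈ c≢end (_ ∷ ≤c) | yes refl = here refl
    max-left-by-E r (s ∷ p) (here c≡r) c≢end (_ ∷ ≤c) | no c≢r = ⊥-elim (c≢r c≡r)
    max-left-by-E r (N ∷ p) (there c∈) c≢end (_ ∷ ≤c) | no _ =
      max-left-by-E (r + weight N) p c∈ (λ c≡end → c≢end (trans c≡end (ℤP.+-assoc r (weight N) (δ p)))) ≤c
    max-left-by-E r (E ∷ p) (there c∈) c≢end (_ ∷ ≤c) | no _ =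
      there (max-left-by-E (r + weight E) p c∈ (λ c≡end → c≢end (trans c≡end (ℤP.+-assoc r (weight E) (δ p)))) ≤c)

    south-max : ∀ {c} r p → c ∈ ranks r p → c ≢ r → All (ℤ._≤ c) (ranks r p) →
      All (+ 0 ℤ.≤_) (ranks r p) → maxℤ (south r p) ≡ c - + m
    south-max {c} r p c∈ c≢r ≤c nonneg =
      maxℤ-unique (south r p) entered (south-below r p ≤c) (All.lookup (south⊆ranks r p nonneg) entered)
      where
      entered : c - + m ∈ south r p
      entered = max-entered-by-N r p c∈ c≢r ≤c

    east-max : ∀ {c} r p → c ∈ ranks r p → c ≢ r + δ p → All (ℤ._≤ c) (ranks r p) →
      All (+ 0 ℤ.≤_) (ranks r p) → maxℤ (east r p) ≡ c - + n
    east-max {c} r p c∈ c≢end ≤c nonneg =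
      maxℤ-unique (east r p) left (east-below r p ≤c) (All.lookup (east⊆ranks r p nonneg) left)
      where
      left : c - + n ∈ east r p
      left = max-left-by-E r p c∈ c≢end ≤c

    -- A nonempty nonnegative walk from 0 starts with an N step, so its
    -- maximal rank is positive.
    maxRank≢0 : ∀ s p → All (+ 0 ℤ.≤_) (ranks (+ 0) (s ∷ p)) → maxℤ (ranks (+ 0) (s ∷ p)) ≢ + 0
    maxRank≢0 E p (_ ∷ nonneg) _ =
      ℤP.<⇒≱ (E-lowers (+ 0)) (All.lookup nonneg (ranks-head (+ 0 + weight E) p))
    maxRank≢0 N p _ max≡0 =
      ℤP.<⇒≱ (N-raises (+ 0))
        (subst (+ 0 + weight N ℤ.≤_) max≡0 (maxℤ-ub (ranks (+ 0) (N ∷ p)) (there (ranks-head (+ 0 + weight N) p))))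

    rank-complement : ∀ D → D ≢ [] → δ D ≡ + 0 → All (+ 0 ℤ.≤_) (ranks (+ 0) D) →
      (south (+ 0) (flipAt (peak D) D) ≐ maxℤ (south (+ 0) D) -minus south (+ 0) D)
      × (east (+ 0) (flipAt (peak D) D) ≐ maxℤ (east (+ 0) D) -minus east (+ 0) D)
    rank-complement [] D≢[] _ _ = ⊥-elim (D≢[] refl)
    rank-complement D@(s ∷ p) _ closed nonneg =
      subst (λ c → south (+ 0) (flipAt (peak D) D) ≐ c -minus south (+ 0) D)
        (sym (south-max (+ 0) D M∈ M≢0 ≤M nonneg))
        (flip-reflects south (+ m) south-++ south-reverse (peak D) D reachesM closed) ,
      subst (λ c → east (+ 0) (flipAt (peak D) D) ≐ c -minus east (+ 0) D)
        (sym (east-max (+ 0) D M∈ M≢end ≤M nonneg))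
        (flip-reflects east (+ n) east-++ east-reverse (peak D) D reachesM closed)
      where
      M : ℤ
      M = maxℤ (ranks (+ 0) D)
      M∈ : M ∈ ranks (+ 0) D
      M∈ = maxRank∈ranks D
      ≤M : All (ℤ._≤ M) (ranks (+ 0) D)
      ≤M = maxℤ-dominates (ranks (+ 0) D)
      reachesM : + 0 + δ (take (peak D) D) ≡ M
      reachesM = prefix-reaches (+ 0) D M∈
      M≢0 : M ≢ + 0
      M≢0 = maxRank≢0 s p nonneg
      M≢end : M ≢ + 0 + δ D
      M≢end M≡end = M≢0 (trans M≡end (trans (ℤP.+-identityˡ (δ D)) closed))

module PathRanks (m n : ℕ) where
  open Walk m n

  rank-move : ∀ P s → rank m n (move P s) ≡ rank m n P + weight s
  rank-move (a , b) N = shift (+ m) (+ n) (+ a) (+ b)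
    where
    shift : ∀ M K A B → M * (+ 1 + B) - K * A ≡ M * B - K * A + M
    shift = solve-∀
  rank-move (a , b) E = shift (+ m) (+ n) (+ a) (+ b)
    where
    shift : ∀ M K A B → M * B - K * (+ 1 + A) ≡ M * B - K * A + - K
    shift = solve-∀

  rank-origin : rank m n (0 , 0) ≡ + 0
  rank-origin = zero-rank (+ m) (+ n)
    where
    zero-rank : ∀ M K → M * + 0 - K * + 0 ≡ + 0
    zero-rank = solve-∀

  pointsFrom≡ranks : ∀ P p → map (rank m n) (pointsFrom P p) ≡ ranks (rank m n P) p
  pointsFrom≡ranks P []      = refl
  pointsFrom≡ranks P (s ∷ p) = cong (rank m n P ∷_)
    (trans (pointsFrom≡ranks (move P s) p) (cong (λ r → ranks r p) (rank-move P s)))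

  southFrom≡south : ∀ P p → southFrom m n P p ≡ south (rank m n P) p
  southFrom≡south P []      = refl
  southFrom≡south P (N ∷ p) = cong (rank m n P ∷_)
    (trans (southFrom≡south (move P N) p) (cong (λ r → south r p) (rank-move P N)))
  southFrom≡south P (E ∷ p) =
    trans (southFrom≡south (move P E) p) (cong (λ r → south r p) (rank-move P E))

  eastFrom≡east : ∀ P p → eastFrom m n P p ≡ east (rank m n P) p
  eastFrom≡east P []      = refl
  eastFrom≡east P (N ∷ p) =
    trans (eastFrom≡east (move P N) p) (cong (λ r → east r p) (rank-move P N))
  eastFrom≡east P (E ∷ p) = cong₂ _∷_ (rank-move P E)
    (trans (eastFrom≡east (move P E) p) (cong (λ r → east r p) (rank-move P E)))

  ranksOfPoints≡ranks : ∀ D → ranksOfPoints m n D ≡ ranks (+ 0) D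
  ranksOfPoints≡ranks D = trans (pointsFrom≡ranks (0 , 0) D) (cong (λ r → ranks r D) rank-origin)

  S≡south : ∀ D → S m n D ≡ south (+ 0) D
  S≡south D = trans (southFrom≡south (0 , 0) D) (cong (λ r → south r D) rank-origin)

  Ea≡east : ∀ D → Ea m n D ≡ east (+ 0) D
  Ea≡east D = trans (eastFrom≡east (0 , 0) D) (cong (λ r → east r D) rank-origin)

  complement≡flipAt : ∀ D → complement m n D ≡ flipAt (peak D) D
  complement≡flipAt D = cong (λ ρ → flipAt (indexOf (maxℤ ρ) ρ) D) (ranksOfPoints≡ranks D)

  S-complement : ∀ D → S m n (complement m n D) ≡ south (+ 0) (flipAt (peak D) D)
  S-complement D = trans (S≡south (complement m n D)) (cong (south (+ 0)) (complement≡flipAt D))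

  Ea-complement : ∀ D → Ea m n (complement m n D) ≡ east (+ 0) (flipAt (peak D) D)
  Ea-complement D = trans (Ea≡east (complement m n D)) (cong (east (+ 0)) (complement≡flipAt D))

  δ-counts : ∀ p → δ p ≡ + m * + countN p - + n * + countE p
  δ-counts []      = sym rank-origin
  δ-counts (N ∷ p) = trans (cong (λ d → + m + d) (δ-counts p)) (step (+ m) (+ n) (+ countN p) (+ countE p))
    where
    step : ∀ M K A B → M + (M * A - K * B) ≡ M * (+ 1 + A) - K * B
    step = solve-∀
  δ-counts (E ∷ p) = trans (cong (λ d → - + n + d) (δ-counts p)) (step (+ m) (+ n) (+ countN p) (+ countE p))
    where
    step : ∀ M K A B → - K + (M * A - K * B) ≡ M * A - K * (+ 1 + B)
    step = solve-∀

  dyck-closed : ∀ {D} → IsDyck m n D → δ D ≡ + 0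
  dyck-closed {D} (#E≡m , #N≡n , _) = begin
    δ D                                ≡⟨ δ-counts D ⟩
    + m * + countN D - + n * + countE D ≡⟨ cong₂ (λ a b → + m * + a - + n * + b) #N≡n #E≡m ⟩
    + m * + n - + n * + m              ≡⟨ commute (+ m) (+ n) ⟩
    + 0                                ∎
    where
    open ≡-Reasoning
    commute : ∀ A B → A * B - B * A ≡ + 0
    commute = solve-∀

  dyck-nonneg : ∀ {D} → IsDyck m n D → All (+ 0 ℤ.≤_) (ranks (+ 0) D)
  dyck-nonneg {D} (_ , _ , aboveLine) =
    subst (All (+ 0 ℤ.≤_)) (ranksOfPoints≡ranks D) (AllP.map⁺ aboveLine)

  dyck-nonempty : ∀ {D} → m ≥ 1 → IsDyck m n D → D ≢ []
  dyck-nonempty m≥1 (#E≡m , _ , _) refl = contradiction (subst (1 ℕ.≤_) (sym #E≡m) m≥1) λ ()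

lemma2p4 : (m n : ℕ) → m ≥ 1 → n ≥ 1 → Coprime m n →
    (D : Path) → IsDyck m n D →
    (S m n (complement m n D) ≐ maxℤ (S m n D) -minus S m n D)
    × (Ea m n (complement m n D) ≐ maxℤ (Ea m n D) -minus Ea m n D)
lemma2p4 m n m≥1 n≥1 _ D dyck =
  subst₂ (λ X Y → X ≐ maxℤ Y -minus Y) (sym (S-complement D)) (sym (S≡south D)) (proj₁ walk-reflected) ,
  subst₂ (λ X Y → X ≐ maxℤ Y -minus Y) (sym (Ea-complement D)) (sym (Ea≡east D)) (proj₂ walk-reflected)
  where
  open Walk m n
  open Extremal m≥1 n≥1
  open PathRanks m n
  walk-reflected :
    (south (+ 0) (flipAt (peak D) D) ≐ maxℤ (south (+ 0) D) -minus south (+ 0) D)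
    × (east (+ 0) (flipAt (peak D) D) ≐ maxℤ (east (+ 0) D) -minus east (+ 0) D)
  walk-reflected = rank-complement D (dyck-nonempty m≥1 dyck) (dyck-closed dyck) (dyck-nonneg dyck)
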